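{- For every positive integer $n$, the continuous run time of any $n$-bit adder tile assembly computer on any input is $\Omega(\log n)$.
   Context: Abstract tile assembly model (aTAM): tiles are unit squares/cubes with a glue type (with nonnegative integer strength) on each side and a label; assemblies are finite sets of translated tiles at distinct integer points; an assembly is $\tau$-stable if the min-cut of its bond graph (adjacent tiles joined with weight equal to the strength of a matching glue, $0$ if glues differ) is at least $\tau$; a tile attaches to $A$ (written $A\to A'$) if the result stays $\tau$-stable. A tile system $(T,S,\tau)$ is deterministic (uniquely assembles $A$) if $A$ is its only terminal producible assembly. Continuous time model: $\Gamma_{MC}$ is the continuous-time Markov chain on producible assemblies with transition rate $1/|T|$ from $A$ to $A'$ whenever $A\to A'$; the continuous run time of a deterministic $\Gamma$ is the expected time for $\Gamma_{MC}$ to go from the seed to the terminal assembly. Tile assembly computer (TAC) $(T,U,V,\tau)$: $T$ has exactly one tile $t_0$ labeled "0" and one $t_1$ labeled "1"; input template $U=(R,B)$ with $R$ an assembly over $T\setminus\{t_0,t_1\}$ and $B$ a sequence of unoccupied positions; $U_b$ places $t_{b_i}$ at $B(i)$; output template $V$ is a sequence of positions $C(i)$, and an assembly represents $c$ if the tile at $C(i)$ has label $c_i$. The TAC computes $f$ if for every input $b$, $(T,U_b,\tau)$ uniquely assembles an assembly representing $f(b)$. An $n$-bit adder TAC computes the $(n+1)$-bit binary sum of two $n$-bit numbers given as its $2n$ input bits. Its continuous run time on input $b$ is the continuous run time of $(T,U_b,\tau)$. -}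

module Defs where

open import Data.Nat using (ℕ; zero; suc; _+_; _*_; _≤_)
open import Data.Nat.DivMod using (_/_; _%_)
open import Data.Nat.Logarithm using (⌊log₂_⌋)
import Data.Nat.ListAction
open import Data.Bool using (Bool; true; false; if_then_else_; _∧_)
open import Data.Fin using (Fin)
open import Data.Integer as ℤ using (ℤ)
open import Data.Rational as ℚ using (ℚ; 0ℚ)
open import Data.Product using (Σ; ∃; _×_; _,_; proj₁; proj₂)
open import Data.Sum using (_⊎_)
open import Data.List as L using (List; []; _∷_; length; allFin; _++_)
open import Data.List.Relation.Unary.All using (All)
open import Data.List.Relation.Unary.Any using (Any)
open import Data.List.Relation.Unary.AllPairs using (AllPairs)
open import Data.List.Membership.Propositional using (_∈_; _∉_)
open import Data.Vec as V using (Vec; _[_]%=_)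
open import Data.Vec.Properties using (≡-dec)
open import Relation.Nullary using (¬_)
open import Relation.Nullary.Decidable using (⌊_⌋)
open import Relation.Binary.PropositionalEquality using (_≡_; _≢_)

Pos : ℕ → Set
Pos d = Vec ℤ d

shift : ∀ {d} → Fin d → Pos d → Pos d
shift i p = p [ i ]%= (ℤ._+_ (ℤ.+ 1))

-- Glue types are natural numbers; the strength of a glue type is
-- given by a function  str : ℕ → ℕ  (part of the tile system).
-- glues t ! i = (glue on the negative-i side , glue on the positive-i side)

record Tile (d : ℕ) : Set where
  constructor mkTile
  field
    label : ℕ              -- labels encoded as naturals; 0 = "0", 1 = "1"
    glues : Vec (ℕ × ℕ) d
open Tile public

-- An assembly: a finite set of tiles placed at integer points
-- (represented as a list; see WellFormed and _≈A_).
Assembly : ℕ → Set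
Assembly d = List (Pos d × Tile d)

positions : ∀ {d} → Assembly d → List (Pos d)
positions = L.map proj₁

WellFormed : ∀ {d} → Assembly d → Set
WellFormed A = AllPairs (λ x y → proj₁ x ≢ proj₁ y) A

_≈A_ : ∀ {d} → Assembly d → Assembly d → Set
A ≈A B = ∀ x → (x ∈ A → x ∈ B) × (x ∈ B → x ∈ A)

_≟P_ : ∀ {d} (p q : Pos d) → _
_≟P_ = ≡-dec ℤ._≟_

sumℕ : List ℕ → ℕ
sumℕ = Data.Nat.ListAction.sum

dirBond : ∀ {d} → (ℕ → ℕ) → Pos d × Tile d → Pos d × Tile d → ℕ
dirBond {d} str (p , t) (q , u) =
  sumℕ (L.map (λ i →
          if ⌊ q ≟P shift i p ⌋ ∧
             ⌊ proj₂ (V.lookup (glues t) i) Data.Nat.≟ proj₁ (V.lookup (glues u) i) ⌋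
          then str (proj₂ (V.lookup (glues t) i)) else 0)
        (allFin d))

bond : ∀ {d} → (ℕ → ℕ) → Pos d × Tile d → Pos d × Tile d → ℕ
bond str x y = dirBond str x y + dirBond str y x

cutWeight : ∀ {d} → (ℕ → ℕ) → (A : Assembly d) → (Fin (length A) → Bool) → ℕ
cutWeight str A c =
  sumℕ (L.map (λ i → sumℕ (L.map (λ j →
          if c i ∧ Data.Bool.not (c j)
          then bond str (L.lookup A i) (L.lookup A j) else 0)
        (allFin (length A)))) (allFin (length A)))

Stable : ∀ {d} → (ℕ → ℕ) → ℕ → Assembly d → Set
Stable str τ A = (c : Fin (length A) → Bool) →
  (∃ λ i → c i ≡ true) → (∃ λ j → c j ≡ false) → τ ≤ cutWeight str A c

record TileSystem (d : ℕ) : Set where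
  constructor mkTS
  field
    str  : ℕ → ℕ
    T    : List (Tile d)
    seed : Assembly d
    τ    : ℕ
open TileSystem public

Step : ∀ {d} → TileSystem d → Assembly d → Assembly d → Set
Step {d} Γ A A' = Σ (Pos d) λ p → Σ (Tile d) λ t →
  (p ∉ positions A) × (t ∈ T Γ) × (A' ≡ (p , t) ∷ A) ×
  Stable (str Γ) (τ Γ) ((p , t) ∷ A)

data Producible {d} (Γ : TileSystem d) : Assembly d → Set where
  seedP : Producible Γ (seed Γ)
  stepP : ∀ {A A'} → Producible Γ A → Step Γ A A' → Producible Γ A'

Terminal : ∀ {d} → TileSystem d → Assembly d → Set
Terminal Γ A = ∀ A' → ¬ Step Γ A A'

UniquelyAssembles : ∀ {d} → TileSystem d → Assembly d → Set
UniquelyAssembles Γ A = Producible Γ A × Terminal Γ A ×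
  (∀ B → Producible Γ B → Terminal Γ B → B ≈A A)

-- Continuous time: expected hitting time of the terminal assembly in the
-- CTMC Γ_MC (rate 1/|T| to each distinct successor assembly).
-- For a non-terminal A with k distinct successors A'_1..A'_k (as sets) the
-- holding time has mean |T|/k, so  t = |T|/k + (1/k) Σ t_i,  i.e.
--  k * t = |T| + Σ t_i.

ℕ→ℚ : ℕ → ℚ
ℕ→ℚ n = ℤ.+ n ℚ./ 1

sumℚ : List ℚ → ℚ
sumℚ = L.foldr ℚ._+_ 0ℚ

data HitTime {d} (Γ : TileSystem d) : Assembly d → ℚ → Set where
  done : ∀ {A} → Terminal Γ A → HitTime Γ A 0ℚ
  step : ∀ {A t} (S : List (Assembly d × ℚ)) →
         All (λ s → Step Γ A (proj₁ s)) S →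
         (∀ A' → Step Γ A A' → Any (λ s → A' ≈A proj₁ s) S) →
         AllPairs (λ s s' → ¬ (proj₁ s ≈A proj₁ s')) S →
         All (λ s → HitTime Γ (proj₁ s) (proj₂ s)) S →
         ℕ→ℚ (length S) ℚ.* t ≡ ℕ→ℚ (length (T Γ)) ℚ.+ sumℚ (L.map proj₂ S) →
         HitTime Γ A t

record TAC (d k m : ℕ) : Set where
  field
    strC   : ℕ → ℕ
    TC     : List (Tile d)
    TC-distinct : AllPairs _≢_ TC
    τC     : ℕ
    t₀ t₁  : Tile d
    t₀∈T   : t₀ ∈ TC
    t₁∈T   : t₁ ∈ TC
    t₀-lab : label t₀ ≡ 0
    t₁-lab : label t₁ ≡ 1
    only-t₀ : ∀ t → t ∈ TC → label t ≡ 0 → t ≡ t₀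
    only-t₁ : ∀ t → t ∈ TC → label t ≡ 1 → t ≡ t₁
    R      : Assembly d
    R-wf   : WellFormed R
    R-T    : All (λ x → proj₂ x ∈ TC) R
    R-no01 : All (λ x → proj₂ x ≢ t₀ × proj₂ x ≢ t₁) R
    B      : Vec (Pos d) k
    B-inj  : ∀ i j → V.lookup B i ≡ V.lookup B j → i ≡ j
    B-free : ∀ i → V.lookup B i ∉ positions R
    C      : Vec (Pos d) m

module _ {d k m : ℕ} (M : TAC d k m) where
  open TAC M

  seedOf : Vec Bool k → Assembly d
  seedOf b = V.toList (V.zipWith (λ p x → p , (if x then t₁ else t₀)) B b) ++ R

  systemOf : Vec Bool k → TileSystem d
  systemOf b = mkTS strC TC (seedOf b) τC

  bitLabel : Bool → ℕ
  bitLabel true  = 1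
  bitLabel false = 0

  Represents : Assembly d → Vec Bool m → Set
  Represents A c = ∀ i → ∃ λ t → (V.lookup C i , t) ∈ A × label t ≡ bitLabel (V.lookup c i)

  Computes : (Vec Bool k → Vec Bool m) → Set
  Computes f = ∀ b → ∃ λ A → UniquelyAssembles (systemOf b) A × Represents A (f b)

  RunTime : Vec Bool k → ℚ → Set
  RunTime b t = HitTime (systemOf b) (seedOf b) t

-- Binary addition (bit vectors are least-significant-bit first)

bitsVal : ∀ {n} → Vec Bool n → ℕ
bitsVal V.[] = 0
bitsVal (x V.∷ xs) = (if x then 1 else 0) + 2 * bitsVal xs

toBits : (m : ℕ) → ℕ → Vec Bool m
toBits zero    x = V.[]
toBits (suc m) x = (⌊ x % 2 Data.Nat.≟ 1 ⌋) V.∷ toBits m (x / 2)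

addFn : (n : ℕ) → Vec Bool (n + n) → Vec Bool (suc n)
addFn n bs = toBits (suc n) (bitsVal (V.take n bs) + bitsVal (V.drop n bs))

IsAdder : ∀ {d} (n : ℕ) → TAC d (n + n) (suc n) → Set
IsAdder n M = Computes M (addFn n)

{-# OPTIONS --safe #-}
module Submission where

-- Let P be the n + 1 output positions of an adder.  Correctness forces them to be pairwise
-- distinct (distinct output bits are distinct functions of the input) and outside the seed
-- (no output bit is a copy of an input bit), while every terminal assembly covers all of them.
-- From an assembly leaving m positions of P empty, the attachments that fill one of them are
-- distinct (position, tile) pairs, so there are at most m |T| of them among the successors, each
-- taken with rate 1 / |T|.  Induction along the hitting-time equation k t = |T| + Σ tᵢ then shows
-- that the expected remaining time is at least the harmonic number H m = 1 + 1/2 + ⋯ + 1/m,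
-- so the run time is at least H (n + 1) ≥ ½ ⌊log₂ n⌋.

open import Defs
open import Data.Nat as ℕ using (ℕ; zero; suc; _+_; _*_; _^_; _≤_; _<_; _≡ᵇ_; s≤s; z≤n)
import Data.Nat.Properties as ℕ
open import Data.Nat.DivMod using (_/_; _%_; m*n%n≡0; m*n/n≡m)
open import Data.Nat.Logarithm using (⌊log₂_⌋; ⌊log₂⌊n/2⌋⌋≡⌊log₂n⌋∸1)
import Data.Nat.Coprimality as Coprime
open import Data.Integer as ℤ using (+≤+)
import Data.Integer.Properties as ℤ
open import Data.Rational as ℚ using (ℚ; 0ℚ; 1ℚ; ½; *≤*)
import Data.Rational.Properties as ℚ
open import Data.Rational.Literals using (fromℤ)
open import Data.Rational.Solver using (module +-*-Solver)
open import Data.Bool as Bool using (Bool; true; false; if_then_else_)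
import Data.Bool.Properties as Bool
open import Data.Fin as Fin using (Fin; toℕ)
import Data.Fin.Properties as Fin
open import Data.Vec as Vec using (Vec; []; _∷_; _++_; lookup; replicate)
import Data.Vec.Properties as Vec
open import Data.List as List using (List; []; _∷_; length; filter; cartesianProduct)
import Data.List.Properties as List
open import Data.List.Relation.Unary.All as All using (All; []; _∷_)
import Data.List.Relation.Unary.All.Properties as All
open import Data.List.Relation.Unary.Any using (here; there)
open import Data.List.Relation.Unary.AllPairs using (AllPairs; []; _∷_)
import Data.List.Relation.Unary.AllPairs.Properties as AllPairs
open import Data.List.Relation.Unary.Unique.Propositional using (Unique)
import Data.List.Relation.Unary.Unique.Propositional.Properties as Unique
open import Data.List.Membership.Propositional using (_∈_; _∉_; _─_)
import Data.List.Membership.Propositional.Properties as Membership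
open import Data.List.Relation.Binary.Subset.Propositional using (_⊆_)
open import Data.Product using (Σ; ∃; _×_; _,_; proj₁; proj₂)
open import Data.Sum using (_⊎_; inj₁; inj₂)
open import Data.Empty using (⊥-elim)
open import Function using (_∘_; Equivalence)
open import Relation.Nullary using (¬_; yes; no; ¬?)
open import Relation.Nullary.Decidable using (⌊_⌋)
open import Relation.Binary.PropositionalEquality
  using (_≡_; _≢_; refl; sym; trans; cong; cong₂; subst; subst₂; module ≡-Reasoning)

open +-*-Solver

fromℕ : ℕ → ℚ
fromℕ n = fromℤ (ℤ.+ n)

ℕ→ℚ≡fromℕ : ∀ n → ℕ→ℚ n ≡ fromℕ n
ℕ→ℚ≡fromℕ n = ℚ.normalize-coprime (Coprime.sym (Coprime.1-coprimeTo n))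

fromℕ-+ : ∀ m n → fromℕ (m + n) ≡ fromℕ m ℚ.+ fromℕ n
fromℕ-+ m n = begin
  fromℕ (m + n)        ≡⟨ sym (ℕ→ℚ≡fromℕ (m + n)) ⟩
  ℤ.+ (m + n) ℚ./ 1    ≡⟨ cong (ℚ._/ 1) (sym (cong₂ ℤ._+_ (ℤ.*-identityʳ (ℤ.+ m))
                                                          (ℤ.*-identityʳ (ℤ.+ n)))) ⟩
  fromℕ m ℚ.+ fromℕ n  ∎
  where open ≡-Reasoning

fromℕ-* : ∀ m n → fromℕ (m * n) ≡ fromℕ m ℚ.* fromℕ n
fromℕ-* m n = trans (sym (ℕ→ℚ≡fromℕ (m * n))) (cong (ℚ._/ 1) (ℤ.pos-* m n))

fromℕ-suc-* : ∀ k q → fromℕ (suc k) ℚ.* q ≡ q ℚ.+ fromℕ k ℚ.* q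
fromℕ-suc-* k q = begin
  fromℕ (suc k) ℚ.* q     ≡⟨ cong (ℚ._* q) (fromℕ-+ 1 k) ⟩
  (1ℚ ℚ.+ fromℕ k) ℚ.* q  ≡⟨ solve 2 (λ k q → (con 1ℚ :+ k) :* q := q :+ k :* q) refl (fromℕ k) q ⟩
  q ℚ.+ fromℕ k ℚ.* q     ∎
  where open ≡-Reasoning

fromℕ-mono-≤ : ∀ {m n} → m ≤ n → fromℕ m ℚ.≤ fromℕ n
fromℕ-mono-≤ {m} {n} m≤n =
  *≤* (subst₂ ℤ._≤_ (sym (ℤ.*-identityʳ (ℤ.+ m))) (sym (ℤ.*-identityʳ (ℤ.+ n))) (+≤+ m≤n))

-- recip 0 = 0 is a junk value; it only ever occurs multiplied by 0.
recip : ℕ → ℚ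
recip zero    = 0ℚ
recip (suc n) = ℚ.1/ fromℕ (suc n)

recip-nonNeg : ∀ n → 0ℚ ℚ.≤ recip n
recip-nonNeg zero    = ℚ.≤-refl
recip-nonNeg (suc n) = ℚ.nonNegative⁻¹ (recip (suc n))

recip-antitone : ∀ {m n} → m ≤ n → recip (suc n) ℚ.≤ recip (suc m)
recip-antitone m≤n =
  *≤* (subst₂ ℤ._≤_ (sym (ℤ.*-identityˡ _)) (sym (ℤ.*-identityˡ _)) (+≤+ (s≤s m≤n)))

fromℕ*recip≡1 : ∀ n → fromℕ (suc n) ℚ.* recip (suc n) ≡ 1ℚ
fromℕ*recip≡1 n = ℚ.*-inverseʳ (fromℕ (suc n))

fromℕ*recip-≤ : ∀ {j} m {n} → j ≤ m * n → fromℕ j ℚ.* recip m ℚ.≤ fromℕ n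
fromℕ*recip-≤ {j} zero {n} _ =
  ℚ.≤-trans (ℚ.≤-reflexive (ℚ.*-zeroʳ (fromℕ j))) (ℚ.nonNegative⁻¹ (fromℕ n))
fromℕ*recip-≤ {j} (suc m) {n} j≤m*n = begin
  fromℕ j ℚ.* x                      ≤⟨ ℚ.*-monoʳ-≤-nonNeg x (fromℕ-mono-≤ j≤m*n) ⟩
  fromℕ (suc m * n) ℚ.* x            ≡⟨ cong (ℚ._* x) (fromℕ-* (suc m) n) ⟩
  fromℕ (suc m) ℚ.* fromℕ n ℚ.* x    ≡⟨ solve 3 (λ a b c → a :* b :* c := b :* (a :* c)) refl
                                                (fromℕ (suc m)) (fromℕ n) x ⟩
  fromℕ n ℚ.* (fromℕ (suc m) ℚ.* x)  ≡⟨ cong (fromℕ n ℚ.*_) (fromℕ*recip≡1 m) ⟩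
  fromℕ n ℚ.* 1ℚ                     ≡⟨ ℚ.*-identityʳ (fromℕ n) ⟩
  fromℕ n                            ∎
  where
  open ℚ.≤-Reasoning
  x = recip (suc m)

mean-≤ : ∀ {a} {X : Set a} (S : List (X × ℚ)) {n t h} → 1 ≤ n →
         fromℕ (length S) ℚ.* t ≡ fromℕ n ℚ.+ sumℚ (List.map proj₂ S) →
         fromℕ (length S) ℚ.* h ℚ.≤ sumℚ (List.map proj₂ S) ℚ.+ fromℕ n → h ℚ.≤ t
mean-≤ [] {suc n} {t} _ eq _ = ⊥-elim (ℚ.<-irrefl 0≡n+1 (ℚ.positive⁻¹ (fromℕ (suc n))))
  where
  0≡n+1 : 0ℚ ≡ fromℕ (suc n)
  0≡n+1 = trans (sym (ℚ.*-zeroˡ t)) (trans eq (ℚ.+-identityʳ (fromℕ (suc n))))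
mean-≤ (x ∷ S) {n} {t} {h} _ eq k*h≤s+n = ℚ.*-cancelˡ-≤-pos (fromℕ (suc (length S))) (begin
  fromℕ (suc (length S)) ℚ.* h  ≤⟨ k*h≤s+n ⟩
  s ℚ.+ fromℕ n                 ≡⟨ ℚ.+-comm s (fromℕ n) ⟩
  fromℕ n ℚ.+ s                 ≡⟨ sym eq ⟩
  fromℕ (suc (length S)) ℚ.* t  ∎)
  where
  open ℚ.≤-Reasoning
  s = sumℚ (List.map proj₂ (x ∷ S))

harmonic : ℕ → ℚ
harmonic zero    = 0ℚ
harmonic (suc n) = harmonic n ℚ.+ recip (suc n)

harmonic-nonNeg : ∀ n → 0ℚ ℚ.≤ harmonic n
harmonic-nonNeg zero    = ℚ.≤-refl
harmonic-nonNeg (suc n) = ℚ.+-mono-≤ (harmonic-nonNeg n) (recip-nonNeg (suc n))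

harmonic-≤-suc : ∀ n → harmonic n ℚ.≤ harmonic (suc n)
harmonic-≤-suc n = ℚ.≤-trans (ℚ.≤-reflexive (sym (ℚ.+-identityʳ (harmonic n))))
                             (ℚ.+-monoʳ-≤ (harmonic n) (recip-nonNeg (suc n)))

harmonic-mono-≤ : ∀ {m n} → m ≤ n → harmonic m ℚ.≤ harmonic n
harmonic-mono-≤ = mono ∘ ℕ.≤⇒≤′
  where
  mono : ∀ {m n} → m ℕ.≤′ n → harmonic m ℚ.≤ harmonic n
  mono ℕ.≤′-refl              = ℚ.≤-refl
  mono (ℕ.≤′-step {n} m≤′n)  = ℚ.≤-trans (mono m≤′n) (harmonic-≤-suc n)

-- Each of the r terms 1/(m+2), …, 1/(m+1+r) is at least 1/(m+1+r).
harmonic-tail : ∀ m r →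
  harmonic (suc m) ℚ.+ fromℕ r ℚ.* recip (suc m + r) ℚ.≤ harmonic (suc m + r)
harmonic-tail m zero rewrite ℕ.+-identityʳ m = ℚ.≤-reflexive (begin-equality
  h ℚ.+ fromℕ 0 ℚ.* recip (suc m)  ≡⟨ cong (h ℚ.+_) (ℚ.*-zeroˡ (recip (suc m))) ⟩
  h ℚ.+ 0ℚ                         ≡⟨ ℚ.+-identityʳ h ⟩
  h                                ∎)
  where
  open ℚ.≤-Reasoning
  h = harmonic (suc m)
harmonic-tail m (suc r) rewrite ℕ.+-suc m r = begin
  h ℚ.+ fromℕ (suc r) ℚ.* x
    ≡⟨ cong (h ℚ.+_) (fromℕ-suc-* r x) ⟩
  h ℚ.+ (x ℚ.+ fromℕ r ℚ.* x)
    ≡⟨ solve 3 (λ h r x → h :+ (x :+ r :* x) := (h :+ r :* x) :+ x) refl h (fromℕ r) x ⟩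
  (h ℚ.+ fromℕ r ℚ.* x) ℚ.+ x
    ≤⟨ ℚ.+-monoˡ-≤ x (ℚ.+-monoʳ-≤ h (ℚ.*-monoˡ-≤-nonNeg (fromℕ r) x≤recip)) ⟩
  (h ℚ.+ fromℕ r ℚ.* recip (suc m + r)) ℚ.+ x
    ≤⟨ ℚ.+-monoˡ-≤ x (harmonic-tail m r) ⟩
  harmonic (suc m + r) ℚ.+ x
    ∎
  where
  open ℚ.≤-Reasoning
  h = harmonic (suc m)
  x = recip (suc (suc m + r))
  x≤recip : x ℚ.≤ recip (suc m + r)
  x≤recip = recip-antitone (ℕ.n≤1+n (m + r))

harmonic-double : ∀ m → harmonic (suc m) ℚ.+ ½ ℚ.≤ harmonic (suc m + suc m)
harmonic-double m = begin
  harmonic (suc m) ℚ.+ ½      ≡⟨ cong (harmonic (suc m) ℚ.+_) (sym x≡½) ⟩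
  harmonic (suc m) ℚ.+ x      ≤⟨ harmonic-tail m (suc m) ⟩
  harmonic (suc m + suc m)    ∎
  where
  open ℚ.≤-Reasoning
  y = recip (suc m + suc m)
  x = fromℕ (suc m) ℚ.* y
  x+x≡1 : x ℚ.+ x ≡ 1ℚ
  x+x≡1 = begin-equality
    x ℚ.+ x                                ≡⟨ sym (ℚ.*-distribʳ-+ y (fromℕ (suc m)) (fromℕ (suc m))) ⟩
    (fromℕ (suc m) ℚ.+ fromℕ (suc m)) ℚ.* y ≡⟨ cong (ℚ._* y) (sym (fromℕ-+ (suc m) (suc m))) ⟩
    fromℕ (suc m + suc m) ℚ.* y            ≡⟨ fromℕ*recip≡1 (m + suc m) ⟩
    1ℚ                                     ∎
  x≡½ : x ≡ ½
  x≡½ = begin-equality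
    x                  ≡⟨ solve 1 (λ x → x := con ½ :* (x :+ x)) refl x ⟩
    ½ ℚ.* (x ℚ.+ x)    ≡⟨ cong (½ ℚ.*_) x+x≡1 ⟩
    ½                  ∎

⌊n/2⌋+⌊n/2⌋≤n : ∀ n → ℕ.⌊ n /2⌋ + ℕ.⌊ n /2⌋ ≤ n
⌊n/2⌋+⌊n/2⌋≤n n = subst (ℕ.⌊ n /2⌋ + ℕ.⌊ n /2⌋ ≤_) (ℕ.⌊n/2⌋+⌈n/2⌉≡n n)
                       (ℕ.+-monoʳ-≤ ℕ.⌊ n /2⌋ (ℕ.⌊n/2⌋≤⌈n/2⌉ n))

⌊log₂⌋≤2*harmonic : ∀ n → fromℕ ⌊log₂ n ⌋ ℚ.≤ harmonic n ℚ.+ harmonic n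
⌊log₂⌋≤2*harmonic n = go ⌊log₂ n ⌋ n refl
  where
  go : ∀ k n → ⌊log₂ n ⌋ ≡ k → fromℕ k ℚ.≤ harmonic n ℚ.+ harmonic n
  go zero    n             _  = ℚ.+-mono-≤ (harmonic-nonNeg n) (harmonic-nonNeg n)
  go (suc k) 0             ()
  go (suc k) 1             ()
  go (suc k) (suc (suc n)) log₂n+2≡1+k = begin
    fromℕ (suc k)
      ≡⟨ fromℕ-+ 1 k ⟩
    1ℚ ℚ.+ fromℕ k
      ≤⟨ ℚ.+-monoʳ-≤ 1ℚ (go k h log₂h≡k) ⟩
    1ℚ ℚ.+ (harmonic h ℚ.+ harmonic h)
      ≡⟨ solve 1 (λ x → con 1ℚ :+ (x :+ x) := (x :+ con ½) :+ (x :+ con ½)) refl (harmonic h) ⟩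
    (harmonic h ℚ.+ ½) ℚ.+ (harmonic h ℚ.+ ½)
      ≤⟨ ℚ.+-mono-≤ (harmonic-double ℕ.⌊ n /2⌋) (harmonic-double ℕ.⌊ n /2⌋) ⟩
    harmonic (h + h) ℚ.+ harmonic (h + h)
      ≤⟨ ℚ.+-mono-≤ (harmonic-mono-≤ h+h≤n+2) (harmonic-mono-≤ h+h≤n+2) ⟩
    harmonic (suc (suc n)) ℚ.+ harmonic (suc (suc n))
      ∎
    where
    open ℚ.≤-Reasoning
    h = suc ℕ.⌊ n /2⌋
    log₂h≡k : ⌊log₂ h ⌋ ≡ k
    log₂h≡k = trans (⌊log₂⌊n/2⌋⌋≡⌊log₂n⌋∸1 (suc (suc n))) (cong (ℕ._∸ 1) log₂n+2≡1+k)
    h+h≤n+2 : h + h ≤ suc (suc n)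
    h+h≤n+2 = subst (_≤ suc (suc n)) (cong suc (sym (ℕ.+-suc ℕ.⌊ n /2⌋ ℕ.⌊ n /2⌋)))
                    (s≤s (s≤s (⌊n/2⌋+⌊n/2⌋≤n n)))

½*⌊log₂⌋≤harmonic : ∀ n → ½ ℚ.* fromℕ ⌊log₂ n ⌋ ℚ.≤ harmonic n
½*⌊log₂⌋≤harmonic n = begin
  ½ ℚ.* fromℕ ⌊log₂ n ⌋              ≤⟨ ℚ.*-monoˡ-≤-nonNeg ½ (⌊log₂⌋≤2*harmonic n) ⟩
  ½ ℚ.* (harmonic n ℚ.+ harmonic n)  ≡⟨ solve 1 (λ x → con ½ :* (x :+ x) := x) refl (harmonic n) ⟩
  harmonic n                         ∎
  where open ℚ.≤-Reasoning

module _ {a} {A : Set a} where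

  ∈-─ : ∀ {x y : A} {xs} → y ∈ xs → y ≢ x → (x∈xs : x ∈ xs) → y ∈ xs ─ x∈xs
  ∈-─ (here refl) y≢x (here refl) = ⊥-elim (y≢x refl)
  ∈-─ (here y≡z)  _   (there _)   = here y≡z
  ∈-─ (there y∈)  _   (here _)    = y∈
  ∈-─ (there y∈)  y≢x (there x∈)  = there (∈-─ y∈ y≢x x∈)

  Unique-length-≤ : ∀ {xs ys : List A} → Unique xs → xs ⊆ ys → length xs ≤ length ys
  Unique-length-≤ {[]}     _              _     = z≤n
  Unique-length-≤ {x ∷ xs} {ys} (x∉xs ∷ xs!) xs⊆ys =
    subst (suc (length xs) ≤_) (sym (List.length-removeAt′ ys _)) (s≤s (Unique-length-≤ xs! xs⊆ys─x))
    where
    xs⊆ys─x : xs ⊆ ys ─ xs⊆ys (here refl)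
    xs⊆ys─x y∈xs =
      ∈-─ (xs⊆ys (there y∈xs)) (λ y≡x → All.lookup x∉xs y∈xs (sym y≡x)) (xs⊆ys (here refl))

module _ {a b} {A : Set a} {B : Set b} where

  length-cartesianProduct : ∀ (xs : List A) (ys : List B) →
                            length (cartesianProduct xs ys) ≡ length xs * length ys
  length-cartesianProduct []       ys = refl
  length-cartesianProduct (x ∷ xs) ys = begin
    length (List.map (x ,_) ys List.++ cartesianProduct xs ys)
      ≡⟨ List.length-++ (List.map (x ,_) ys) ⟩
    length (List.map (x ,_) ys) + length (cartesianProduct xs ys)
      ≡⟨ cong₂ _+_ (List.length-map (x ,_) ys) (length-cartesianProduct xs ys) ⟩
    length ys + length xs * length ys
      ∎
    where open ≡-Reasoning

module _ {d : ℕ} where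

  ∈-positions : ∀ {A : Assembly d} {x} → x ∈ A → proj₁ x ∈ positions A
  ∈-positions = Membership.∈-map⁺ proj₁

  ≈A-reflexive : ∀ {X Y : Assembly d} → X ≡ Y → X ≈A Y
  ≈A-reflexive refl _ = (λ x∈ → x∈) , (λ x∈ → x∈)

  open import Data.List.Membership.DecPropositional (_≟P_ {d}) using (_∈?_)

  missing : Assembly d → List (Pos d) → List (Pos d)
  missing A = filter (λ q → ¬? (q ∈? positions A))

  missing-covered : ∀ {A P} → All (_∈ positions A) P → missing A P ≡ []
  missing-covered covered = List.filter-none _ (All.map (λ q∈A q∉A → q∉A q∈A) covered)

  missing-disjoint : ∀ {A P} → All (_∉ positions A) P → missing A P ≡ P
  missing-disjoint = List.filter-all _

  ∈-missing : ∀ {A P q} → q ∈ P → q ∉ positions A → q ∈ missing A P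
  ∈-missing = Membership.∈-filter⁺ _

  missing-∷-∉ : ∀ {A P p} u → p ∉ P → missing ((p , u) ∷ A) P ≡ missing A P
  missing-∷-∉ {P = []} u p∉P = refl
  missing-∷-∉ {A} {q ∷ P} {p} u p∉P with q ≟P p | q ∈? positions A
  ... | yes refl | _     = ⊥-elim (p∉P (here refl))
  ... | no _     | yes _ = missing-∷-∉ u (p∉P ∘ there)
  ... | no _     | no _  = cong (q ∷_) (missing-∷-∉ u (p∉P ∘ there))

  length-missing-∷-∈ : ∀ {A P p} u → Unique P → p ∈ P → p ∉ positions A →
                       length (missing A P) ≡ suc (length (missing ((p , u) ∷ A) P))
  length-missing-∷-∈ {A} {q ∷ P} {p} u (q∉P ∷ P!) p∈q∷P p∉A with q ≟P p | q ∈? positions A | p∈q∷P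
  ... | yes refl | yes q∈A | _         = ⊥-elim (p∉A q∈A)
  ... | yes refl | no _    | _         =
    cong (suc ∘ length) (sym (missing-∷-∉ u (λ p∈P → All.lookup q∉P p∈P refl)))
  ... | no q≢p   | _       | here q≡p  = ⊥-elim (q≢p (sym q≡p))
  ... | no _     | yes _   | there p∈P = length-missing-∷-∈ u P! p∈P p∉A
  ... | no _     | no _    | there p∈P = cong suc (length-missing-∷-∈ u P! p∈P p∉A)

module _ {d : ℕ} (Γ : TileSystem d) where

  seed⊆producible : ∀ {X} → Producible Γ X → seed Γ ⊆ X
  seed⊆producible seedP                                 x∈seed = x∈seed
  seed⊆producible (stepP pX (_ , _ , _ , _ , refl , _)) x∈seed = there (seed⊆producible pX x∈seed)

  seed-positions⊆producible : ∀ {X} → Producible Γ X → positions (seed Γ) ⊆ positions X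
  seed-positions⊆producible pX q∈seed with Membership.∈-map⁻ proj₁ q∈seed
  ... | _ , x∈seed , refl = ∈-positions (seed⊆producible pX x∈seed)

  producible-at-seed-position : ∀ {X x} → Producible Γ X → x ∈ X →
                                proj₁ x ∈ positions (seed Γ) → x ∈ seed Γ
  producible-at-seed-position seedP x∈X _ = x∈X
  producible-at-seed-position (stepP pX (_ , _ , p∉X , _ , refl , _)) (here refl) p∈seed =
    ⊥-elim (p∉X (seed-positions⊆producible pX p∈seed))
  producible-at-seed-position (stepP pX (_ , _ , _ , _ , refl , _)) (there x∈X) q∈seed =
    producible-at-seed-position pX x∈X q∈seed

  producible-unique-off-seed : ∀ {X q u u′} → Producible Γ X → (q , u) ∈ X → (q , u′) ∈ X →
                               q ∉ positions (seed Γ) → u ≡ u′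
  producible-unique-off-seed seedP x∈X _ q∉seed = ⊥-elim (q∉seed (∈-positions x∈X))
  producible-unique-off-seed (stepP pX (_ , _ , p∉X , _ , refl , _)) (here refl) x′∈ _ with x′∈
  ... | here refl   = refl
  ... | there x′∈X  = ⊥-elim (p∉X (∈-positions x′∈X))
  producible-unique-off-seed (stepP pX (_ , _ , p∉X , _ , refl , _)) (there x∈X) x′∈ q∉seed with x′∈
  ... | here refl   = ⊥-elim (p∉X (∈-positions x∈X))
  ... | there x′∈X  = producible-unique-off-seed pX x∈X x′∈X q∉seed

module HittingTime {d : ℕ} (Γ : TileSystem d) (P : List (Pos d)) (P-unique : Unique P)
  (terminal-covers : ∀ A → Producible Γ A → Terminal Γ A → All (_∈ positions A) P)
  (T-nonempty : 1 ≤ length (T Γ)) where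

  open import Data.List.Membership.DecPropositional (_≟P_ {d}) using (_∈?_)

  uncovered : Assembly d → ℕ
  uncovered A = length (missing A P)

  Steps : Assembly d → List (Assembly d × ℚ) → Set
  Steps A = All (Step Γ A ∘ proj₁)

  Distinct : List (Assembly d × ℚ) → Set
  Distinct = AllPairs (λ s s′ → ¬ proj₁ s ≈A proj₁ s′)

  Dominated : List (Assembly d × ℚ) → Set
  Dominated = All (λ s → harmonic (uncovered (proj₁ s)) ℚ.≤ proj₂ s)

  attachment : ∀ {A A′} → Step Γ A A′ → Pos d × Tile d
  attachment (p , u , _) = p , u

  attachment-determines : ∀ {A A′ A″} (st : Step Γ A A′) (st′ : Step Γ A A″) →
                          attachment st ≡ attachment st′ → A′ ≡ A″
  attachment-determines (_ , _ , _ , _ , refl , _) (_ , _ , _ , _ , refl , _) refl = refl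

  attachments : ∀ {A S} → Steps A S → List (Pos d × Tile d)
  attachments = All.reduce attachment

  hits : ∀ {A S} → Steps A S → List (Pos d × Tile d)
  hits = filter ((_∈? P) ∘ proj₁) ∘ attachments

  attachments-unique : ∀ {A S} (steps : Steps A S) → Distinct S → Unique (attachments steps)
  attachments-unique []           []                = []
  attachments-unique {A} (st ∷ steps) (st≉ ∷ distinct) =
    differ steps st≉ ∷ attachments-unique steps distinct
    where
    differ : ∀ {S} (steps : Steps A S) → All (λ s → ¬ _ ≈A proj₁ s) S →
             All (attachment st ≢_) (attachments steps)
    differ []             []       = []
    differ (st′ ∷ steps) (≉ ∷ ≉s) =
      (≉ ∘ ≈A-reflexive ∘ attachment-determines st st′) ∷ differ steps ≉s

  attachments-fresh : ∀ {A S} (steps : Steps A S) →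
                      All (λ x → proj₁ x ∉ positions A × proj₂ x ∈ T Γ) (attachments steps)
  attachments-fresh []                                  = []
  attachments-fresh ((_ , _ , p∉A , u∈T , _) ∷ steps) = (p∉A , u∈T) ∷ attachments-fresh steps

  hits⊆missing×T : ∀ {A S} (steps : Steps A S) → hits steps ⊆ cartesianProduct (missing A P) (T Γ)
  hits⊆missing×T steps x∈hits with Membership.∈-filter⁻ _ x∈hits
  ... | x∈attachments , p∈P with All.lookup (attachments-fresh steps) x∈attachments
  ...   | p∉A , u∈T = Membership.∈-cartesianProduct⁺ (∈-missing p∈P p∉A) u∈T

  length-hits-≤ : ∀ {A S} (steps : Steps A S) → Distinct S →
                  length (hits steps) ≤ uncovered A * length (T Γ)
  length-hits-≤ {A} steps distinct =
    subst (length (hits steps) ≤_) (length-cartesianProduct (missing A P) (T Γ))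
      (Unique-length-≤ (AllPairs.filter⁺ _ (attachments-unique steps distinct)) (hits⊆missing×T steps))

  -- A hit lowers uncovered by one, so H (uncovered A) ≤ tᵢ + 1 / uncovered A; other steps keep it.
  harmonic-sum-≤ : ∀ {A S} (steps : Steps A S) → Dominated S →
    fromℕ (length S) ℚ.* harmonic (uncovered A) ℚ.≤
    sumℚ (List.map proj₂ S) ℚ.+ fromℕ (length (hits steps)) ℚ.* recip (uncovered A)
  harmonic-sum-≤ {A} [] [] = ℚ.≤-reflexive (begin-equality
    0ℚ ℚ.* h          ≡⟨ ℚ.*-zeroˡ h ⟩
    0ℚ                ≡⟨ sym (ℚ.*-zeroˡ x) ⟩
    0ℚ ℚ.* x          ≡⟨ sym (ℚ.+-identityˡ (0ℚ ℚ.* x)) ⟩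
    0ℚ ℚ.+ 0ℚ ℚ.* x   ∎)
    where
    open ℚ.≤-Reasoning
    h = harmonic (uncovered A)
    x = recip (uncovered A)
  harmonic-sum-≤ {A} {(_ , t) ∷ S} ((p , u , p∉A , _ , refl , _) ∷ steps) (h′≤t ∷ dominated)
    with p ∈? P
  ... | yes p∈P = begin
    fromℕ (suc k) ℚ.* h
      ≡⟨ fromℕ-suc-* k h ⟩
    h ℚ.+ fromℕ k ℚ.* h
      ≤⟨ ℚ.+-mono-≤ h≤t+x (harmonic-sum-≤ steps dominated) ⟩
    (t ℚ.+ x) ℚ.+ (s ℚ.+ fromℕ j ℚ.* x)
      ≡⟨ solve 4 (λ t x s j → (t :+ x) :+ (s :+ j :* x) := (t :+ s) :+ (x :+ j :* x)) refl t x s (fromℕ j) ⟩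
    (t ℚ.+ s) ℚ.+ (x ℚ.+ fromℕ j ℚ.* x)
      ≡⟨ cong ((t ℚ.+ s) ℚ.+_) (sym (fromℕ-suc-* j x)) ⟩
    (t ℚ.+ s) ℚ.+ fromℕ (suc j) ℚ.* x
      ∎
    where
    open ℚ.≤-Reasoning
    k = length S
    h = harmonic (uncovered A)
    x = recip (uncovered A)
    s = sumℚ (List.map proj₂ S)
    j = length (hits steps)
    h≤t+x : h ℚ.≤ t ℚ.+ x
    h≤t+x = subst (λ m → harmonic m ℚ.≤ t ℚ.+ recip m) (sym (length-missing-∷-∈ u P-unique p∈P p∉A))
                  (ℚ.+-monoˡ-≤ _ h′≤t)
  ... | no p∉P = begin
    fromℕ (suc k) ℚ.* h
      ≡⟨ fromℕ-suc-* k h ⟩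
    h ℚ.+ fromℕ k ℚ.* h
      ≤⟨ ℚ.+-mono-≤ h≤t (harmonic-sum-≤ steps dominated) ⟩
    t ℚ.+ (s ℚ.+ fromℕ j ℚ.* x)
      ≡⟨ sym (ℚ.+-assoc t s (fromℕ j ℚ.* x)) ⟩
    (t ℚ.+ s) ℚ.+ fromℕ j ℚ.* x
      ∎
    where
    open ℚ.≤-Reasoning
    k = length S
    h = harmonic (uncovered A)
    x = recip (uncovered A)
    s = sumℚ (List.map proj₂ S)
    j = length (hits steps)
    h≤t : h ℚ.≤ t
    h≤t = subst (λ m → harmonic m ℚ.≤ t) (cong length (missing-∷-∉ u p∉P)) h′≤t

  mutual
    harmonic-≤-hitTime : ∀ {A t} → Producible Γ A → HitTime Γ A t → harmonic (uncovered A) ℚ.≤ t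
    harmonic-≤-hitTime {A} pA (done terminal) rewrite missing-covered (terminal-covers A pA terminal) =
      ℚ.≤-refl
    harmonic-≤-hitTime {A} {t} pA (step S steps _ distinct times eq) =
      mean-≤ S T-nonempty k*t≡|T|+s (begin
        fromℕ (length S) ℚ.* harmonic (uncovered A)
          ≤⟨ harmonic-sum-≤ steps (harmonic-≤-hitTimes pA steps times) ⟩
        s ℚ.+ fromℕ (length (hits steps)) ℚ.* recip (uncovered A)
          ≤⟨ ℚ.+-monoʳ-≤ s (fromℕ*recip-≤ (uncovered A) (length-hits-≤ steps distinct)) ⟩
        s ℚ.+ fromℕ (length (T Γ))
          ∎)
      where
      open ℚ.≤-Reasoning
      s = sumℚ (List.map proj₂ S)
      k*t≡|T|+s : fromℕ (length S) ℚ.* t ≡ fromℕ (length (T Γ)) ℚ.+ s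
      k*t≡|T|+s = subst₂ (λ k n → k ℚ.* t ≡ n ℚ.+ s)
                         (ℕ→ℚ≡fromℕ (length S)) (ℕ→ℚ≡fromℕ (length (T Γ))) eq

    harmonic-≤-hitTimes : ∀ {A S} → Producible Γ A → (steps : Steps A S) →
                          All (λ s → HitTime Γ (proj₁ s) (proj₂ s)) S → Dominated S
    harmonic-≤-hitTimes pA []           []             = []
    harmonic-≤-hitTimes pA (st ∷ steps) (time ∷ times) =
      harmonic-≤-hitTime (stepP pA st) time ∷ harmonic-≤-hitTimes pA steps times

zeros : ∀ n → Vec Bool n
zeros n = replicate n false

unitVec : ∀ {n} → Fin n → Vec Bool n
unitVec Fin.zero    = true ∷ zeros _
unitVec (Fin.suc k) = false ∷ unitVec k

bitsVal-zeros : ∀ n → bitsVal (zeros n) ≡ 0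
bitsVal-zeros zero    = refl
bitsVal-zeros (suc n) = cong (2 *_) (bitsVal-zeros n)

bitsVal-unitVec : ∀ {n} (k : Fin n) → bitsVal (unitVec k) ≡ 2 ^ toℕ k
bitsVal-unitVec {suc n} Fin.zero = cong (λ v → 1 + 2 * v) (bitsVal-zeros n)
bitsVal-unitVec (Fin.suc k)      = cong (2 *_) (bitsVal-unitVec k)

lookup-unitVec : ∀ {n} (k : Fin n) → lookup (unitVec k) k ≡ true
lookup-unitVec Fin.zero    = refl
lookup-unitVec (Fin.suc k) = lookup-unitVec k

lookup-toBits-0 : ∀ m (i : Fin m) → lookup (toBits m 0) i ≡ false
lookup-toBits-0 (suc m) Fin.zero    = refl
lookup-toBits-0 (suc m) (Fin.suc i) = lookup-toBits-0 m i

toBits-2* : ∀ m y → toBits (suc m) (2 * y) ≡ false ∷ toBits m y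
toBits-2* m y = cong₂ (λ r q → ⌊ r ℕ.≟ 1 ⌋ ∷ toBits m q) 2y%2≡0 2y/2≡y
  where
  2y%2≡0 : (2 * y) % 2 ≡ 0
  2y%2≡0 = trans (cong (_% 2) (ℕ.*-comm 2 y)) (m*n%n≡0 y 2)
  2y/2≡y : (2 * y) / 2 ≡ y
  2y/2≡y = trans (cong (_/ 2) (ℕ.*-comm 2 y)) (m*n/n≡m y 2)

lookup-toBits-2^ : ∀ m x (i : Fin m) → lookup (toBits m (2 ^ x)) i ≡ (toℕ i ≡ᵇ x)
lookup-toBits-2^ (suc m) zero    Fin.zero    = refl
lookup-toBits-2^ (suc m) zero    (Fin.suc i) = lookup-toBits-0 m i
lookup-toBits-2^ (suc m) (suc x) i rewrite toBits-2* m (2 ^ x) with i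
... | Fin.zero  = refl
... | Fin.suc i = lookup-toBits-2^ m x i

take-++ : ∀ {A : Set} m {n} (xs : Vec A m) (ys : Vec A n) → Vec.take m (xs ++ ys) ≡ xs
take-++ zero    []       ys = refl
take-++ (suc m) (x ∷ xs) ys = cong (x ∷_) (take-++ m xs ys)

drop-++ : ∀ {A : Set} m {n} (xs : Vec A m) (ys : Vec A n) → Vec.drop m (xs ++ ys) ≡ ys
drop-++ zero    []       ys = refl
drop-++ (suc m) (x ∷ xs) ys = drop-++ m xs ys

lookup-addFn-2^ : ∀ n (a b : Vec Bool n) {x} → bitsVal a + bitsVal b ≡ 2 ^ x →
                  ∀ i → lookup (addFn n (a ++ b)) i ≡ (toℕ i ≡ᵇ x)
lookup-addFn-2^ n a b {x} a+b≡2^x i = begin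
  lookup (addFn n (a ++ b)) i
    ≡⟨ cong₂ (λ a b → lookup (toBits (suc n) (bitsVal a + bitsVal b)) i) (take-++ n a b) (drop-++ n a b) ⟩
  lookup (toBits (suc n) (bitsVal a + bitsVal b)) i
    ≡⟨ cong (λ v → lookup (toBits (suc n) v) i) a+b≡2^x ⟩
  lookup (toBits (suc n) (2 ^ x)) i
    ≡⟨ lookup-toBits-2^ (suc n) x i ⟩
  (toℕ i ≡ᵇ x)
    ∎
  where open ≡-Reasoning

≡ᵇ-true⇒≡ : ∀ m n → (m ≡ᵇ n) ≡ true → m ≡ n
≡ᵇ-true⇒≡ m n = ℕ.≡ᵇ⇒≡ m n ∘ Equivalence.from Bool.T-≡

≡⇒≡ᵇ-true : ∀ m n → m ≡ n → (m ≡ᵇ n) ≡ true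
≡⇒≡ᵇ-true m n = Equivalence.to Bool.T-≡ ∘ ℕ.≡⇒≡ᵇ m n

module _ (n : ℕ) where

  OutputCopiesInput : Fin (suc n) → Fin (n + n) → Set
  OutputCopiesInput i j = ∀ b → lookup (addFn n b) i ≡ lookup b j

  OutputBitsAgree : Fin (suc n) → Fin (suc n) → Set
  OutputBitsAgree i i′ = ∀ b → lookup (addFn n b) i ≡ lookup (addFn n b) i′

  unit+zeros : ∀ (k : Fin n) → bitsVal (unitVec k) + bitsVal (zeros n) ≡ 2 ^ toℕ k
  unit+zeros k rewrite bitsVal-unitVec k | bitsVal-zeros n = ℕ.+-identityʳ (2 ^ toℕ k)

  zeros+unit : ∀ (k : Fin n) → bitsVal (zeros n) + bitsVal (unitVec k) ≡ 2 ^ toℕ k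
  zeros+unit k rewrite bitsVal-unitVec k | bitsVal-zeros n = refl

  unit+unit : ∀ (k : Fin n) → bitsVal (unitVec k) + bitsVal (unitVec k) ≡ 2 ^ suc (toℕ k)
  unit+unit k rewrite bitsVal-unitVec k = cong (2 ^ toℕ k +_) (sym (ℕ.+-identityʳ (2 ^ toℕ k)))

  -- Both inputs set bit j, but their sums 2^x and 2^(x+1) set different output bits.
  ¬copies-input : ∀ i j (a b a′ b′ : Vec Bool n) x →
                  bitsVal a + bitsVal b ≡ 2 ^ x → bitsVal a′ + bitsVal b′ ≡ 2 ^ suc x →
                  lookup (a ++ b) j ≡ true → lookup (a′ ++ b′) j ≡ true → ¬ OutputCopiesInput i j
  ¬copies-input i j a b a′ b′ x sum sum′ bit bit′ copies = ℕ.1+n≢n (trans (sym i≡1+x) i≡x)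
    where
    i≡x : toℕ i ≡ x
    i≡x = ≡ᵇ-true⇒≡ (toℕ i) x
            (trans (sym (lookup-addFn-2^ n a b sum i)) (trans (copies (a ++ b)) bit))
    i≡1+x : toℕ i ≡ suc x
    i≡1+x = ≡ᵇ-true⇒≡ (toℕ i) (suc x)
              (trans (sym (lookup-addFn-2^ n a′ b′ sum′ i)) (trans (copies (a′ ++ b′)) bit′))

  output≢input : ∀ i j → ¬ OutputCopiesInput i j
  output≢input i j with Fin.splitAt n j in split
  ... | inj₁ k = ¬copies-input i j (unitVec k) (zeros n) (unitVec k) (unitVec k) (toℕ k)
                   (unit+zeros k) (unit+unit k) (left-bit (zeros n)) (left-bit (unitVec k))
    where
    left-bit : ∀ b → lookup (unitVec k ++ b) j ≡ true
    left-bit b = subst (λ j → lookup (unitVec k ++ b) j ≡ true) (Fin.splitAt⁻¹-↑ˡ split)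
                       (trans (Vec.lookup-++ˡ (unitVec k) b k) (lookup-unitVec k))
  ... | inj₂ k = ¬copies-input i j (zeros n) (unitVec k) (unitVec k) (unitVec k) (toℕ k)
                   (zeros+unit k) (unit+unit k) (right-bit (zeros n)) (right-bit (unitVec k))
    where
    right-bit : ∀ a → lookup (a ++ unitVec k) j ≡ true
    right-bit a = subst (λ j → lookup (a ++ unitVec k) j ≡ true) (Fin.splitAt⁻¹-↑ʳ split)
                        (trans (Vec.lookup-++ʳ a (unitVec k) k) (lookup-unitVec k))

  low-output-bit-unique : ∀ i i′ → toℕ i < n → OutputBitsAgree i i′ → toℕ i′ ≡ toℕ i
  low-output-bit-unique i i′ i<n agree =
    ≡ᵇ-true⇒≡ (toℕ i′) (toℕ i)
      (trans (sym (bit i′)) (trans (sym (agree input)) (trans (bit i) (≡⇒≡ᵇ-true (toℕ i) (toℕ i) refl))))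
    where
    k = Fin.fromℕ< i<n
    input = unitVec k ++ zeros n
    bit : ∀ i′ → lookup (addFn n input) i′ ≡ (toℕ i′ ≡ᵇ toℕ i)
    bit = lookup-addFn-2^ n (unitVec k) (zeros n) (trans (unit+zeros k) (cong (2 ^_) (Fin.toℕ-fromℕ< i<n)))

  output-bits-injective : ∀ i i′ → OutputBitsAgree i i′ → i ≡ i′
  output-bits-injective i i′ agree with toℕ i ℕ.<? n | toℕ i′ ℕ.<? n
  ... | yes i<n | _        = Fin.toℕ-injective (sym (low-output-bit-unique i i′ i<n agree))
  ... | no _    | yes i′<n = Fin.toℕ-injective (low-output-bit-unique i′ i i′<n (sym ∘ agree))
  ... | no i≮n  | no i′≮n  = Fin.toℕ-injective (trans (top i i≮n) (sym (top i′ i′≮n)))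
    where
    top : ∀ (i : Fin (suc n)) → ¬ toℕ i < n → toℕ i ≡ n
    top i i≮n = ℕ.≤-antisym (ℕ.s≤s⁻¹ (Fin.toℕ<n i)) (ℕ.≮⇒≥ i≮n)

module _ {d k m : ℕ} (M : TAC d k m) where
  open TAC M

  bitTile : Bool → Tile d
  bitTile x = if x then t₁ else t₀

  label-bitTile : ∀ x → label (bitTile x) ≡ bitLabel M x
  label-bitTile true  = t₁-lab
  label-bitTile false = t₀-lab

  bitLabel-injective : ∀ x y → bitLabel M x ≡ bitLabel M y → x ≡ y
  bitLabel-injective true  true  _ = refl
  bitLabel-injective false false _ = refl

  inputTiles : ∀ {l} → Vec (Pos d) l → Vec Bool l → Assembly d
  inputTiles ps b = Vec.toList (Vec.zipWith (λ p x → p , bitTile x) ps b)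

  ∈-inputTiles⁺ : ∀ {l} (ps : Vec (Pos d) l) b j → (lookup ps j , bitTile (lookup b j)) ∈ inputTiles ps b
  ∈-inputTiles⁺ (p ∷ ps) (x ∷ b) Fin.zero    = here refl
  ∈-inputTiles⁺ (p ∷ ps) (x ∷ b) (Fin.suc j) = there (∈-inputTiles⁺ ps b j)

  ∈-inputTiles⁻ : ∀ {l} (ps : Vec (Pos d) l) b {q t} → (q , t) ∈ inputTiles ps b →
                  ∃ λ j → q ≡ lookup ps j × t ≡ bitTile (lookup b j)
  ∈-inputTiles⁻ []       []      ()
  ∈-inputTiles⁻ (p ∷ ps) (x ∷ b) (here refl) = Fin.zero , refl , refl
  ∈-inputTiles⁻ (p ∷ ps) (x ∷ b) (there q∈) with ∈-inputTiles⁻ ps b q∈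
  ... | j , q≡ , t≡ = Fin.suc j , q≡ , t≡

  input-position∈seed : ∀ b j → lookup B j ∈ positions (seedOf M b)
  input-position∈seed b j = ∈-positions (Membership.∈-++⁺ˡ (∈-inputTiles⁺ B b j))

  -- R contains neither t₀ nor t₁, so a bit-labelled seed tile is an input tile.
  bit-tile∈seed : ∀ b {q t} x → (q , t) ∈ seedOf M b → label t ≡ bitLabel M x →
                  ∃ λ j → q ≡ lookup B j × t ≡ bitTile (lookup b j)
  bit-tile∈seed b x q∈seed label≡ with Membership.∈-++⁻ (inputTiles B b) q∈seed
  ... | inj₁ q∈input = ∈-inputTiles⁻ B b q∈input
  ... | inj₂ q∈R with All.lookup R-T q∈R | All.lookup R-no01 q∈R | x
  ...   | t∈T | t≢t₀ , _ | false = ⊥-elim (t≢t₀ (only-t₀ _ t∈T label≡))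
  ...   | t∈T | _ , t≢t₁ | true  = ⊥-elim (t≢t₁ (only-t₁ _ t∈T label≡))

module AdderOutputs {d n : ℕ} (M : TAC d (n + n) (suc n)) (adder : IsAdder n M) where
  open TAC M

  assembled : Vec Bool (n + n) → Assembly d
  assembled b = proj₁ (adder b)

  assembled-producible : ∀ b → Producible (systemOf M b) (assembled b)
  assembled-producible b = proj₁ (proj₁ (proj₂ (adder b)))

  assembled-unique : ∀ b A → Producible (systemOf M b) A → Terminal (systemOf M b) A → A ≈A assembled b
  assembled-unique b = proj₂ (proj₂ (proj₁ (proj₂ (adder b))))

  assembled-represents : ∀ b → Represents M (assembled b) (addFn n b)
  assembled-represents b = proj₂ (proj₂ (adder b))

  output-in-seed-copies-input : ∀ b i → lookup C i ∈ positions (seedOf M b) →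
                                ∃ λ j → lookup C i ≡ lookup B j × lookup (addFn n b) i ≡ lookup b j
  output-in-seed-copies-input b i Ci∈seed with assembled-represents b i
  ... | t , Ci∈ , label≡
    with bit-tile∈seed M b _ (producible-at-seed-position _ (assembled-producible b) Ci∈ Ci∈seed) label≡
  ... | j , Ci≡Bj , t≡ =
    j , Ci≡Bj , bitLabel-injective M _ _
                  (trans (sym label≡) (trans (cong label t≡) (label-bitTile M (lookup b j))))

  output-at-input-copies : ∀ i j → lookup C i ≡ lookup B j → OutputCopiesInput n i j
  output-at-input-copies i j Ci≡Bj b
    with output-in-seed-copies-input b i
           (subst (_∈ positions (seedOf M b)) (sym Ci≡Bj) (input-position∈seed M b j))
  ... | j′ , Ci≡Bj′ , copies with B-inj j′ j (trans (sym Ci≡Bj′) Ci≡Bj)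
  ... | refl = copies

  output∉seed : ∀ b i → lookup C i ∉ positions (seedOf M b)
  output∉seed b i Ci∈seed with output-in-seed-copies-input b i Ci∈seed
  ... | j , Ci≡Bj , _ = output≢input n i j (output-at-input-copies i j Ci≡Bj)

  output-positions-injective : ∀ i i′ → lookup C i ≡ lookup C i′ → i ≡ i′
  output-positions-injective i i′ Ci≡Ci′ = output-bits-injective n i i′ agree
    where
    agree : OutputBitsAgree n i i′
    agree b with assembled-represents b i | assembled-represents b i′
    ... | t , Ci∈ , label≡ | t′ , Ci′∈ , label′≡ =
      bitLabel-injective M _ _ (trans (sym label≡) (trans (cong label t≡t′) label′≡))
      where
      t≡t′ : t ≡ t′
      t≡t′ = producible-unique-off-seed _ (assembled-producible b) Ci∈
               (subst (λ q → (q , t′) ∈ assembled b) (sym Ci≡Ci′) Ci′∈) (output∉seed b i)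

  outputPositions : List (Pos d)
  outputPositions = List.tabulate (lookup C)

  outputPositions-unique : Unique outputPositions
  outputPositions-unique = Unique.tabulate⁺ (output-positions-injective _ _)

  terminal-covers-outputs : ∀ b A → Producible (systemOf M b) A → Terminal (systemOf M b) A →
                            All (_∈ positions A) outputPositions
  terminal-covers-outputs b A pA terminal = All.tabulate⁺ λ i →
    let (t , Ci∈ , _) = assembled-represents b i in
    ∈-positions (proj₂ (assembled-unique b A pA terminal _) Ci∈)

  length-missing-outputs-seed : ∀ b → length (missing (seedOf M b) outputPositions) ≡ suc n
  length-missing-outputs-seed b =
    trans (cong length (missing-disjoint (All.tabulate⁺ (output∉seed b)))) (List.length-tabulate (lookup C))

mainTheorem15 : Σ ℚ λ c → (0ℚ ℚ.< c) × Σ ℕ λ N →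
    ∀ n → N ≤ n → ∀ d → (d ≡ 2 ⊎ d ≡ 3) →
    (M : TAC d (n + n) (suc n)) → IsAdder n M →
    (b : Vec Bool (n + n)) → (t : ℚ) → RunTime M b t →
    c ℚ.* ℕ→ℚ ⌊log₂ n ⌋ ℚ.≤ t
mainTheorem15 = ½ , ℚ.positive⁻¹ ½ , 0 , λ n _ d _ M adder b t runTime →
  let open AdderOutputs M adder
      open HittingTime (systemOf M b) outputPositions outputPositions-unique
                       (terminal-covers-outputs b) (Membership.∈-length (TAC.t₀∈T M))
  in begin
  ½ ℚ.* ℕ→ℚ ⌊log₂ n ⌋                ≡⟨ cong (½ ℚ.*_) (ℕ→ℚ≡fromℕ ⌊log₂ n ⌋) ⟩
  ½ ℚ.* fromℕ ⌊log₂ n ⌋              ≤⟨ ½*⌊log₂⌋≤harmonic n ⟩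
  harmonic n                         ≤⟨ harmonic-≤-suc n ⟩
  harmonic (suc n)                   ≡⟨ cong harmonic (sym (length-missing-outputs-seed b)) ⟩
  harmonic (uncovered (seedOf M b))  ≤⟨ harmonic-≤-hitTime seedP runTime ⟩
  t                                  ∎
  where open ℚ.≤-Reasoning
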